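{- Let $G$ be an undirected graph, $M\subseteq V(G)$ a vertex cover of $G$, $A\subseteq V(G)$, and $I=V(G)\setminus M$. Let $H_2$ be the bipartite graph with parts $L_2=\binom{M}{2}$ and $R_2=I\setminus A$, in which a pair $\{x,y\}\in L_2$ is adjacent to $u\in R_2$ iff $\{x,y\}\subseteq N_G(u)$. Say that a path $P$ of $G$ occupies an edge $(\{x,y\},u)$ of $H_2$ if $xu$ and $uy$ are both edges of $P$. Then: (1) If an $A$-path $P$ of $G$ occupies two distinct edges $e_1,e_2$ of $H_2$, then $e_1$ and $e_2$ share no endpoint in $H_2$. (2) If $P_1,P_2$ are vertex-disjoint $A$-paths of $G$, $P_1$ occupies $e_1\in E(H_2)$ and $P_2$ occupies $e_2\in E(H_2)$, then $e_1$ and $e_2$ share no endpoint in $H_2$.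
   Context: For an undirected graph $G$ and $A\subseteq V(G)$, an $A$-path is a path in $G$ that starts and ends at two distinct vertices of $A$ and whose internal vertices all lie in $V(G)\setminus A$. -}

module Defs where

open import Level using (0ℓ)
open import Data.List using (List; []; _∷_; _++_; [_])
open import Data.List.Membership.Propositional using (_∈_)
open import Data.List.Relation.Unary.All using (All)
open import Data.List.Relation.Unary.Unique.Propositional using (Unique)
open import Data.List.Relation.Unary.Linked using (Linked)
open import Data.Product using (_×_; Σ)
open import Data.Sum using (_⊎_)
open import Data.Empty using (⊥)
open import Relation.Nullary using (¬_)
open import Relation.Binary.PropositionalEquality using (_≡_)

record Graph : Set₁ where
  field
    V    : Set
    Adj  : V → V → Set
    sym  : ∀ {x y} → Adj x y → Adj y x
    irr  : ∀ {x} → ¬ Adj x x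

Subset : Set → Set₁
Subset V = V → Set

module _ (G : Graph) where
  open Graph G

  IsVertexCover : Subset V → Set
  IsVertexCover M = ∀ {x y} → Adj x y → M x ⊎ M y

  record Path : Set where
    constructor mkPath
    field
      verts  : List V
      nonemp : ¬ (verts ≡ [])
      uniq   : Unique verts
      linked : Linked Adj verts

  data Consec : List V → V → V → Set where
    here  : ∀ {x y l} → Consec (x ∷ y ∷ l) x y
    there : ∀ {z l x y} → Consec l x y → Consec (z ∷ l) x y

  EdgeOfPath : Path → V → V → Set
  EdgeOfPath P x y = Consec (Path.verts P) x y ⊎ Consec (Path.verts P) y x

  record IsAPath (A : Subset V) (P : Path) : Set where
    field
      start  : V
      inner  : List V
      end    : V
      shape  : Path.verts P ≡ start ∷ (inner ++ [ end ])
      startA : A start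
      endA   : A end
      distinct : ¬ (start ≡ end)
      innerA : All (λ v → ¬ A v) inner

  -- Edges of the bipartite graph H₂: a pair {x,y} of distinct vertices of M
  -- (represented by an ordered pair, identified up to swapping) and a vertex
  -- u ∈ R₂ = I ∖ A = (V ∖ M) ∖ A with {x,y} ⊆ N_G(u).
  record H2Edge (M A : Subset V) : Set where
    constructor h2edge
    field
      x y u : V
      xM : M x
      yM : M y
      x≢y : ¬ (x ≡ y)
      uI : ¬ M u
      uA : ¬ A u
      xu : Adj x u
      yu : Adj y u

  module _ {M A : Subset V} where
    open H2Edge

    SamePair : V → V → V → V → Set
    SamePair x y x' y' = (x ≡ x' × y ≡ y') ⊎ (x ≡ y' × y ≡ x')

    SameH2Edge : H2Edge M A → H2Edge M A → Set
    SameH2Edge e f = SamePair (x e) (y e) (x f) (y f) × u e ≡ u f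

    ShareEndpoint : H2Edge M A → H2Edge M A → Set
    ShareEndpoint e f = SamePair (x e) (y e) (x f) (y f) ⊎ u e ≡ u f

    Occupies : Path → H2Edge M A → Set
    Occupies P e = EdgeOfPath P (x e) (u e) × EdgeOfPath P (u e) (y e)

  VertexDisjoint : Path → Path → Set
  VertexDisjoint P Q = ∀ {v} → v ∈ Path.verts P → v ∈ Path.verts Q → ⊥

{-# OPTIONS --safe #-}
-- Numbering the vertices of a path by position, path
-- edges join consecutive positions and positions determine vertices. Hence a
-- vertex has at most two path-neighbours, and two distinct vertices have at
-- most one common path-neighbour. Two occupied edges sharing the centre u thus
-- both carry the pair of path-neighbours of u, and two occupied edges sharing
-- the pair {x,y} both have a common path-neighbour of x and y as centre. In (2)
-- a shared endpoint would be a vertex of both paths.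
module Submission where

open import Defs
open import Data.Empty using (⊥-elim)
open import Data.Fin using (toℕ)
open import Data.Fin.Properties using (toℕ-injective)
open import Data.List.Membership.Propositional using (_∈_)
open import Data.List.Membership.Propositional.Properties.WithK using (unique⇒irrelevant)
open import Data.List.Membership.Setoid.Properties using (index-injective)
open import Data.List.Relation.Unary.Any using (here; there; index)
open import Data.List.Relation.Unary.Unique.Propositional using (Unique)
open import Data.Nat using (ℕ; suc)
open import Data.Product using (Σ; _×_; _,_; proj₁; proj₂)
open import Data.Sum using (_⊎_; inj₁; inj₂; swap; map)
open import Function using (_∘_)
open import Relation.Nullary using (¬_)
open import Relation.Binary.PropositionalEquality using (_≡_; _≢_; refl; cong; setoid)

Adjacent : ℕ → ℕ → Set
Adjacent i j = suc i ≡ j ⊎ suc j ≡ i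

adjacent-to-same⇒one-of : ∀ {i j k m} → Adjacent i k → Adjacent j k → Adjacent m k →
                          i ≢ j → m ≡ i ⊎ m ≡ j
adjacent-to-same⇒one-of (inj₁ refl) (inj₁ refl) _           i≢j = ⊥-elim (i≢j refl)
adjacent-to-same⇒one-of (inj₂ refl) (inj₂ refl) _           i≢j = ⊥-elim (i≢j refl)
adjacent-to-same⇒one-of (inj₁ refl) (inj₂ refl) (inj₁ refl) _   = inj₁ refl
adjacent-to-same⇒one-of (inj₁ refl) (inj₂ refl) (inj₂ refl) _   = inj₂ refl
adjacent-to-same⇒one-of (inj₂ refl) (inj₁ refl) (inj₁ refl) _   = inj₂ refl
adjacent-to-same⇒one-of (inj₂ refl) (inj₁ refl) (inj₂ refl) _   = inj₁ refl

common-adjacent-unique : ∀ {i j k l} → Adjacent i k → Adjacent j k → Adjacent i l → Adjacent j l →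
                         i ≢ j → k ≡ l
common-adjacent-unique (inj₁ refl) (inj₁ refl) _ _ i≢j = ⊥-elim (i≢j refl)
common-adjacent-unique (inj₂ refl) (inj₂ refl) _ _ i≢j = ⊥-elim (i≢j refl)
common-adjacent-unique (inj₁ refl) (inj₂ refl) (inj₁ refl) _           _ = refl
common-adjacent-unique (inj₁ refl) (inj₂ refl) (inj₂ refl) (inj₁ ())   _
common-adjacent-unique (inj₁ refl) (inj₂ refl) (inj₂ refl) (inj₂ ())   _
common-adjacent-unique (inj₂ refl) (inj₁ refl) (inj₂ refl) _           _ = refl
common-adjacent-unique (inj₂ refl) (inj₁ refl) (inj₁ refl) (inj₁ ())   _
common-adjacent-unique (inj₂ refl) (inj₁ refl) (inj₁ refl) (inj₂ ())   _

module _ {V : Set} where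

  position : ∀ {x : V} {xs} → x ∈ xs → ℕ
  position = toℕ ∘ index

  position-injective : ∀ {x y : V} {xs} (p : x ∈ xs) (q : y ∈ xs) →
                       position p ≡ position q → x ≡ y
  position-injective p q = index-injective (setoid V) p q ∘ toℕ-injective

  unique⇒position-irrelevant : ∀ {x : V} {xs} → Unique xs → (p q : x ∈ xs) →
                               position p ≡ position q
  unique⇒position-irrelevant u p q = cong position (unique⇒irrelevant u p q)

module _ (G : Graph) where

  consec⇒successive-positions : ∀ {l a b} → Consec G l a b →
                                Σ (a ∈ l) λ p → Σ (b ∈ l) λ q → suc (position p) ≡ position q
  consec⇒successive-positions here = here refl , there (here refl) , refl
  consec⇒successive-positions (there c) with consec⇒successive-positions c
  ... | p , q , eq = there p , there q , cong suc eq

  module _ (P : Path G) where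
    open Path P using (verts; uniq)

    edge⇒∈ : ∀ {a b} → EdgeOfPath G P a b → a ∈ verts × b ∈ verts
    edge⇒∈ (inj₁ c) with consec⇒successive-positions c
    ... | p , q , _ = p , q
    edge⇒∈ (inj₂ c) with consec⇒successive-positions c
    ... | q , p , _ = p , q

    edge⇒adjacent-positions : ∀ {a b} → EdgeOfPath G P a b → (p : a ∈ verts) (q : b ∈ verts) →
                              Adjacent (position p) (position q)
    edge⇒adjacent-positions (inj₁ c) p q with consec⇒successive-positions c
    ... | p′ , q′ , eq
      rewrite unique⇒position-irrelevant uniq p p′ | unique⇒position-irrelevant uniq q q′ = inj₁ eq
    edge⇒adjacent-positions (inj₂ c) p q with consec⇒successive-positions c
    ... | q′ , p′ , eq
      rewrite unique⇒position-irrelevant uniq p p′ | unique⇒position-irrelevant uniq q q′ = inj₂ eq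

    neighbours-at-most-two : ∀ {u a b c} → EdgeOfPath G P u a → EdgeOfPath G P u b →
                             EdgeOfPath G P u c → a ≢ b → c ≡ a ⊎ c ≡ b
    neighbours-at-most-two {u} ua ub uc a≢b =
      map (position-injective pc pa) (position-injective pc pb)
          (adjacent-to-same⇒one-of (adjacent ua pa) (adjacent ub pb) (adjacent uc pc)
                                   (a≢b ∘ position-injective pa pb))
      where
      pu = proj₁ (edge⇒∈ ua)
      pa = proj₂ (edge⇒∈ ua)
      pb = proj₂ (edge⇒∈ ub)
      pc = proj₂ (edge⇒∈ uc)
      adjacent : ∀ {w} → EdgeOfPath G P u w → (pw : w ∈ verts) → Adjacent (position pw) (position pu)
      adjacent uw pw = edge⇒adjacent-positions (swap uw) pw pu

    common-neighbour-unique : ∀ {a b u v} → EdgeOfPath G P a u → EdgeOfPath G P u b →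
                              EdgeOfPath G P a v → EdgeOfPath G P v b → a ≢ b → u ≡ v
    common-neighbour-unique au ub av vb a≢b =
      position-injective pu pv
        (common-adjacent-unique (edge⇒adjacent-positions au pa pu) (edge⇒adjacent-positions (swap ub) pb pu)
                                (edge⇒adjacent-positions av pa pv) (edge⇒adjacent-positions (swap vb) pb pv)
                                (a≢b ∘ position-injective pa pb))
      where
      pa = proj₁ (edge⇒∈ au)
      pu = proj₂ (edge⇒∈ au)
      pb = proj₂ (edge⇒∈ ub)
      pv = proj₂ (edge⇒∈ av)

module _ {G : Graph} {M A : Subset (Graph.V G)} where
  open Graph G using (V)

  one-of-each⇒samePair : ∀ {a b c d : V} → c ≡ a ⊎ c ≡ b → d ≡ a ⊎ d ≡ b → c ≢ d →
                         SamePair G {M} {A} a b c d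
  one-of-each⇒samePair (inj₁ refl) (inj₁ refl) c≢d = ⊥-elim (c≢d refl)
  one-of-each⇒samePair (inj₁ refl) (inj₂ refl) _   = inj₁ (refl , refl)
  one-of-each⇒samePair (inj₂ refl) (inj₁ refl) _   = inj₂ (refl , refl)
  one-of-each⇒samePair (inj₂ refl) (inj₂ refl) c≢d = ⊥-elim (c≢d refl)

  occupied-share⇒same : (P : Path G) (e₁ e₂ : H2Edge G M A) → Occupies G P e₁ → Occupies G P e₂ →
                        ShareEndpoint G e₁ e₂ → SameH2Edge G e₁ e₂
  occupied-share⇒same P (h2edge x₁ y₁ u _ _ x₁≢y₁ _ _ _ _) (h2edge x₂ y₂ .u _ _ x₂≢y₂ _ _ _ _)
                      (x₁u , uy₁) (x₂u , uy₂) (inj₂ refl) =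
    one-of-each⇒samePair (neighbour-of-u (swap x₂u)) (neighbour-of-u uy₂) x₂≢y₂ , refl
    where
    neighbour-of-u : ∀ {c} → EdgeOfPath G P u c → c ≡ x₁ ⊎ c ≡ y₁
    neighbour-of-u uc = neighbours-at-most-two G P (swap x₁u) uy₁ uc x₁≢y₁
  occupied-share⇒same P (h2edge _ _ _ _ _ x≢y _ _ _ _) (h2edge _ _ _ _ _ _ _ _ _ _)
                      (xu₁ , u₁y) (xu₂ , u₂y) (inj₁ (inj₁ (refl , refl))) =
    inj₁ (refl , refl) , common-neighbour-unique G P xu₁ u₁y xu₂ u₂y x≢y
  occupied-share⇒same P (h2edge _ _ _ _ _ x≢y _ _ _ _) (h2edge _ _ _ _ _ _ _ _ _ _)
                      (xu₁ , u₁y) (yu₂ , u₂x) (inj₁ (inj₂ (refl , refl))) =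
    inj₂ (refl , refl) , common-neighbour-unique G P xu₁ u₁y (swap u₂x) (swap yu₂) x≢y

  disjoint-occupied⇒¬share : (P₁ P₂ : Path G) (e₁ e₂ : H2Edge G M A) → VertexDisjoint G P₁ P₂ →
                             Occupies G P₁ e₁ → Occupies G P₂ e₂ → ¬ ShareEndpoint G e₁ e₂
  disjoint-occupied⇒¬share P₁ P₂ _ _ disjoint (x₁u₁ , _) (x₂u₂ , _) (inj₂ refl) =
    disjoint (proj₂ (edge⇒∈ G P₁ x₁u₁)) (proj₂ (edge⇒∈ G P₂ x₂u₂))
  disjoint-occupied⇒¬share P₁ P₂ _ _ disjoint (x₁u₁ , _) (x₂u₂ , _) (inj₁ (inj₁ (refl , _))) =
    disjoint (proj₁ (edge⇒∈ G P₁ x₁u₁)) (proj₁ (edge⇒∈ G P₂ x₂u₂))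
  disjoint-occupied⇒¬share P₁ P₂ _ _ disjoint (x₁u₁ , _) (_ , u₂y₂) (inj₁ (inj₂ (refl , _))) =
    disjoint (proj₁ (edge⇒∈ G P₁ x₁u₁)) (proj₂ (edge⇒∈ G P₂ u₂y₂))

mainTheorem6 : (G : Graph) → (M A : Subset (Graph.V G)) → IsVertexCover G M
    → (∀ (P : Path G) (e₁ e₂ : H2Edge G M A) → IsAPath G A P
        → Occupies G P e₁ → Occupies G P e₂ → ¬ SameH2Edge G e₁ e₂
        → ¬ ShareEndpoint G e₁ e₂)
    × (∀ (P₁ P₂ : Path G) (e₁ e₂ : H2Edge G M A) → IsAPath G A P₁ → IsAPath G A P₂
        → VertexDisjoint G P₁ P₂ → Occupies G P₁ e₁ → Occupies G P₂ e₂
        → ¬ ShareEndpoint G e₁ e₂)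
mainTheorem6 G M A _ =
  (λ P e₁ e₂ _ o₁ o₂ e₁≉e₂ → e₁≉e₂ ∘ occupied-share⇒same P e₁ e₂ o₁ o₂) ,
  (λ P₁ P₂ e₁ e₂ _ _ → disjoint-occupied⇒¬share P₁ P₂ e₁ e₂)
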